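{- Let $\Delta$ be a shellable $d$-dimensional simplicial complex on ground set $V$, and let $F$ be a $(d+1)$-subset of $V$ such that the simplicial complex $\Delta'$ generated by $\Delta\cup\{F\}$ is shellable. Then any shelling of $\Delta$ can be extended to a shelling of $\Delta'$ by adding $F$ as the last facet.
   Context: A simplicial complex is a family of subsets of a finite set closed under subsets; the complex generated by a family is the smallest complex containing it. A pure $d$-dimensional complex is shellable if its facets can be ordered $F_1,\dots,F_s$ (a shelling) so that for each $k\ge 2$ the complex generated by the sets $F_i\cap F_k$, $i<k$, is pure of dimension $d-1$. -}

module Defs where

open import Data.Nat using (ℕ; suc; _≥_)
open import Data.Fin using (Fin; toℕ)
open import Data.Fin.Subset using (Subset; _⊆_; _∩_; ∣_∣)
open import Data.List using (List; length; lookup; take; map)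
open import Data.List.Membership.Propositional using (_∈_)
open import Data.List.Relation.Unary.Unique.Propositional using (Unique)
open import Data.Product using (Σ; ∃; _×_)
open import Data.Sum using (_⊎_)
open import Relation.Binary.PropositionalEquality using (_≡_)

-- Ground set V = Fin n; a face is a subset of V; a family of subsets is a predicate.
Family : ℕ → Set₁
Family n = Subset n → Set

IsComplex : ∀ {n} → Family n → Set
IsComplex {n} Δ = ∀ (G H : Subset n) → H ⊆ G → Δ G → Δ H

Generated : ∀ {n} → Family n → Family n
Generated {n} 𝓕 G = Σ (Subset n) (λ H → 𝓕 H × G ⊆ H)

GeneratedL : ∀ {n} → List (Subset n) → Family n
GeneratedL L = Generated (λ H → H ∈ L)

Facet : ∀ {n} → Family n → Subset n → Set
Facet {n} Δ G = Δ G × (∀ (H : Subset n) → Δ H → G ⊆ H → H ≡ G)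

-- pure of dimension d, written with s = d + 1 = size of the facets:
-- there is a face of size s, and every facet has size s.
PureOfSize : ∀ {n} → ℕ → Family n → Set
PureOfSize {n} s Δ =
  Σ (Subset n) (λ G → Δ G × ∣ G ∣ ≡ s) × (∀ (G : Subset n) → Facet Δ G → ∣ G ∣ ≡ s)

-- L = F_1,...,F_s is a shelling of the pure d-dimensional complex Δ:
-- an ordering (without repetition) of exactly the facets of Δ such that for each
-- k ≥ 2 (0-based index k ≥ 1) the complex generated by F_i ∩ F_k, i < k,
-- is pure of dimension d - 1 (facet size d).
IsShelling : ∀ {n} → ℕ → Family n → List (Subset n) → Set
IsShelling {n} d Δ L =
  Unique L
  × (∀ (G : Subset n) → G ∈ L → Facet Δ G)
  × (∀ (G : Subset n) → Facet Δ G → G ∈ L)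
  × (∀ (k : Fin (length L)) → toℕ k ≥ 1 →
       PureOfSize d (GeneratedL (map (λ H → H ∩ lookup L k) (take (toℕ k) L))))

Shellable : ∀ {n} → ℕ → Family n → Set
Shellable {n} d Δ = PureOfSize (suc d) Δ × Σ (List (Subset n)) (λ L → IsShelling d Δ L)

-- Fix a shelling M of Δ' = ⟨Δ ∪ {F}⟩.  The facets of Δ' are F and the facets
-- of Δ, so only the new last step of L ++ [ F ] needs an argument: every face σ
-- of some G ∩ F (G a facet of Δ) must lie in some C ∩ F of size d.  Induct on
-- the position of G in M.  If G precedes F in M, the shelling condition of M at F
-- gives such a C directly.  If G follows F, the condition at G gives an earlier C
-- with σ ⊆ C and |C ∩ G| = d; either C = F, and then G ∩ F itself has size d, or
-- C is an earlier facet of Δ containing σ and the induction hypothesis applies.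
module Submission where

open import Defs
open import Data.Nat using (ℕ; suc)
open import Data.Fin.Subset using (Subset; ∣_∣)
open import Data.List using (List; _++_; [_])
open import Data.Sum using (_⊎_)
open import Relation.Nullary using (¬_)
open import Relation.Binary.PropositionalEquality using (_≡_)

open import Data.Nat using (_≤_; _<_; _≥_; z≤n; s≤s)
open import Data.Bool.Properties using () renaming (_≟_ to _≟ᵇ_)
open import Data.Empty using (⊥-elim)
open import Data.Fin using (Fin; toℕ; zero; suc) renaming (_<_ to _<ᶠ_)
open import Data.Fin.Induction using (<-wellFounded)
open import Data.Fin.Properties using (<-cmp)
open import Data.Fin.Subset using (_⊆_; _∩_; inside; outside)
open import Data.Fin.Subset.Properties
  using (⊆-refl; ⊆-trans; ⊆-antisym; _⊆?_; p∩q⊆p; p∩q⊆q; x∈p∩q⁺; ∩-comm; ∩-idem;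
         drop-∷-⊆; p⊆q⇒∣p∣≤∣q∣)
open import Data.List using (length; lookup; take; map; filter; []; _∷_)
open import Data.List.Extrema.Nat using (argmax; argmax-all; f[xs]≤f[argmax])
open import Data.List.Membership.Propositional using (_∈_)
open import Data.List.Membership.Propositional.Properties
  using (∈-map⁺; ∈-map⁻; ∈-++⁻; ∈-++⁺ˡ; ∈-++⁺ʳ; ∈-filter⁺; ∈-filter⁻)
open import Data.List.Membership.Setoid.Properties using (∈-lookup)
open import Data.List.Relation.Unary.All as All using ()
open import Data.List.Relation.Unary.Any using (here; there; index)
open import Data.List.Relation.Unary.Any.Properties using (lookup-index)
open import Data.List.Relation.Unary.AllPairs using ([]; _∷_)
open import Data.List.Relation.Unary.Unique.Propositional.Properties using (++⁺)
open import Data.Nat.Properties using (≤-trans; ≤-reflexive; 1+n≰n; 1+n≢n)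
open import Data.Product using (∃; _×_; _,_; proj₁; proj₂)
open import Data.Sum using (inj₁; inj₂; [_,_]′)
open import Data.Vec.Base as Vec using ([]; _∷_)
open import Data.Vec.Properties using (≡-dec)
open import Induction.WellFounded using (Acc; acc)
open import Relation.Binary.Definitions using (tri<; tri≈; tri>)
open import Relation.Binary.PropositionalEquality
  using (_≢_; refl; sym; trans; cong; subst; setoid; module ≡-Reasoning)
open import Relation.Nullary using (Dec; yes; no; contradiction)

open ≡-Reasoning

_≟ˢ_ : ∀ {n} (p q : Subset n) → Dec (p ≡ q)
_≟ˢ_ = ≡-dec _≟ᵇ_

p⊆q∧∣q∣≤∣p∣⇒p≡q : ∀ {n} {p q : Subset n} → p ⊆ q → ∣ q ∣ ≤ ∣ p ∣ → p ≡ q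
p⊆q∧∣q∣≤∣p∣⇒p≡q {p = []}          {[]}          _   _ = refl
p⊆q∧∣q∣≤∣p∣⇒p≡q {p = outside ∷ p} {outside ∷ q} p⊆q ∣q∣≤∣p∣ =
  cong (outside ∷_) (p⊆q∧∣q∣≤∣p∣⇒p≡q (drop-∷-⊆ p⊆q) ∣q∣≤∣p∣)
p⊆q∧∣q∣≤∣p∣⇒p≡q {p = outside ∷ p} {inside ∷ q}  p⊆q ∣q∣≤∣p∣ =
  ⊥-elim (1+n≰n (≤-trans ∣q∣≤∣p∣ (p⊆q⇒∣p∣≤∣q∣ (drop-∷-⊆ p⊆q))))
p⊆q∧∣q∣≤∣p∣⇒p≡q {p = inside ∷ p}  {outside ∷ q} p⊆q _ with p⊆q Vec.here
... | ()
p⊆q∧∣q∣≤∣p∣⇒p≡q {p = inside ∷ p}  {inside ∷ q}  p⊆q (s≤s ∣q∣≤∣p∣) =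
  cong (inside ∷_) (p⊆q∧∣q∣≤∣p∣⇒p≡q (drop-∷-⊆ p⊆q) ∣q∣≤∣p∣)

⊆-∩⁺ : ∀ {n} {σ p q : Subset n} → σ ⊆ p → σ ⊆ q → σ ⊆ p ∩ q
⊆-∩⁺ σ⊆p σ⊆q x∈σ = x∈p∩q⁺ (σ⊆p x∈σ , σ⊆q x∈σ)

module _ {A : Set} where

  lookup∈take : ∀ (xs : List A) {k} (c : Fin (length xs)) → toℕ c < k → lookup xs c ∈ take k xs
  lookup∈take (x ∷ xs) {suc k} zero    _         = here refl
  lookup∈take (x ∷ xs) {suc k} (suc c) (s≤s c<k) = there (lookup∈take xs c c<k)

  ∈-take⁻ : ∀ (xs : List A) {k x} → x ∈ take k xs → ∃ λ c → toℕ c < k × lookup xs c ≡ x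
  ∈-take⁻ (y ∷ xs) {suc k} (here x≡y) = zero , s≤s z≤n , sym x≡y
  ∈-take⁻ (y ∷ xs) {suc k} (there x∈) with ∈-take⁻ xs x∈
  ... | c , c<k , refl = suc c , s≤s c<k , refl

  Prefixwise : (List A → A → Set) → List A → Set
  Prefixwise Q xs = ∀ (k : Fin (length xs)) → toℕ k ≥ 1 → Q (take (toℕ k) xs) (lookup xs k)

  Prefixwise-∷ʳ : ∀ {Q xs y} → Prefixwise Q xs → (∀ {x} → x ∈ xs → Q xs y) →
    Prefixwise Q (xs ++ [ y ])
  Prefixwise-∷ʳ {xs = []}              _   _    zero ()
  Prefixwise-∷ʳ {xs = x ∷ xs}          _   _    zero ()
  Prefixwise-∷ʳ {xs = x ∷ []}          _   last (suc zero) _ = last (here refl)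
  Prefixwise-∷ʳ {xs = x ∷ x′ ∷ xs}     Qxs _    (suc zero) _ = Qxs (suc zero) (s≤s z≤n)
  Prefixwise-∷ʳ {Q} {x ∷ x′ ∷ xs} {y} Qxs last (suc (suc k)) _ =
    Prefixwise-∷ʳ {λ ps → Q (x ∷ ps)} {x′ ∷ xs} {y}
      (λ k _ → Qxs (suc k) (s≤s z≤n)) (λ _ → last (here refl)) (suc k) (s≤s z≤n)

module _ {n : ℕ} where

  -- A largest member of ys containing σ is a facet of the generated complex.
  facet-⊇ : ∀ {σ G : Subset n} {ys} → G ∈ ys → σ ⊆ G →
    ∃ λ B → B ∈ ys × σ ⊆ B × Facet (GeneratedL ys) B
  facet-⊇ {σ} {G} {ys} G∈ys σ⊆G = B , B∈ys , σ⊆B , (B , B∈ys , ⊆-refl) , maximal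
    where
    B : Subset n
    B = argmax ∣_∣ G (filter (σ ⊆?_) ys)

    B∈ys×σ⊆B : B ∈ ys × σ ⊆ B
    B∈ys×σ⊆B = argmax-all ∣_∣ (G∈ys , λ {x} → σ⊆G) (All.tabulate (∈-filter⁻ (σ ⊆?_)))

    B∈ys : B ∈ ys
    B∈ys = proj₁ B∈ys×σ⊆B

    σ⊆B : σ ⊆ B
    σ⊆B = proj₂ B∈ys×σ⊆B

    largest : ∀ {C} → C ∈ ys → σ ⊆ C → ∣ C ∣ ≤ ∣ B ∣
    largest C∈ys σ⊆C =
      All.lookup (f[xs]≤f[argmax] G (filter (σ ⊆?_) ys)) (∈-filter⁺ (σ ⊆?_) C∈ys σ⊆C)

    maximal : ∀ H → GeneratedL ys H → B ⊆ H → H ≡ B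
    maximal H (C , C∈ys , H⊆C) B⊆H
      with p⊆q∧∣q∣≤∣p∣⇒p≡q (⊆-trans B⊆H H⊆C) (largest C∈ys (⊆-trans σ⊆B (⊆-trans B⊆H H⊆C)))
    ... | refl = ⊆-antisym H⊆C B⊆H

  PureOfSize-GeneratedL : ∀ {s y} {ys : List (Subset n)} → y ∈ ys →
    (∀ {σ} → GeneratedL ys σ → ∃ λ R → R ∈ ys × σ ⊆ R × ∣ R ∣ ≡ s) →
    PureOfSize s (GeneratedL ys)
  PureOfSize-GeneratedL {s} {y} {ys} y∈ys cover with cover (y , y∈ys , ⊆-refl)
  ... | R , R∈ys , _ , ∣R∣ = (R , (R , R∈ys , ⊆-refl) , ∣R∣) , facets-size
    where
    facets-size : ∀ τ → Facet (GeneratedL ys) τ → ∣ τ ∣ ≡ s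
    facets-size τ (τ-face , maximal) with cover τ-face
    ... | R′ , R′∈ys , τ⊆R′ , ∣R′∣ = subst (λ X → ∣ X ∣ ≡ s) (maximal R′ (R′ , R′∈ys , ⊆-refl) τ⊆R′) ∣R′∣

module _ {n d} {D : Family n} {M : List (Subset n)} (shelling : IsShelling d D M) where

  shelling-step : ∀ {σ} {k l : Fin (length M)} → toℕ l < toℕ k →
    σ ⊆ lookup M l → σ ⊆ lookup M k →
    ∃ λ c → toℕ c < toℕ k × σ ⊆ lookup M c × ∣ lookup M c ∩ lookup M k ∣ ≡ d
  shelling-step {k = k} {l} l<k σ⊆Mₗ σ⊆Mₖ
    with facet-⊇ (∈-map⁺ (_∩ lookup M k) (lookup∈take M l l<k)) (⊆-∩⁺ σ⊆Mₗ σ⊆Mₖ)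
  ... | B , B∈ , σ⊆B , B-facet with ∈-map⁻ (_∩ lookup M k) B∈
  ... | C , C∈ , refl with ∈-take⁻ M C∈
  ... | c , c<k , refl =
    c , c<k , ⊆-trans σ⊆B (p∩q⊆p _ _) ,
    proj₂ (proj₂ (proj₂ (proj₂ shelling)) k (≤-trans (s≤s z≤n) l<k)) _ B-facet

  shelling-ridge : ∀ {σ F G} → F ∈ M → ∣ F ∣ ≡ suc d → G ∈ M → G ≢ F →
    σ ⊆ G → σ ⊆ F → ∃ λ C → C ∈ M × C ≢ F × σ ⊆ C × ∣ C ∩ F ∣ ≡ d
  shelling-ridge {σ} F∈M ∣F∣ G∈M
    with index F∈M | lookup-index F∈M | index G∈M | lookup-index G∈M
  ... | j | refl | i | refl = go i (<-wellFounded i)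
    where
    Mⱼ : Subset n
    Mⱼ = lookup M j

    ≢Mⱼ : ∀ {C} → ∣ C ∩ Mⱼ ∣ ≡ d → C ≢ Mⱼ
    ≢Mⱼ ∣Mⱼ∩Mⱼ∣ refl = 1+n≢n (begin
      suc d        ≡⟨ sym ∣F∣ ⟩
      ∣ Mⱼ ∣       ≡⟨ cong ∣_∣ (sym (∩-idem Mⱼ)) ⟩
      ∣ Mⱼ ∩ Mⱼ ∣  ≡⟨ ∣Mⱼ∩Mⱼ∣ ⟩
      d            ∎)

    go : ∀ i → Acc _<ᶠ_ i → lookup M i ≢ Mⱼ → σ ⊆ lookup M i → σ ⊆ Mⱼ →
      ∃ λ C → C ∈ M × C ≢ Mⱼ × σ ⊆ C × ∣ C ∩ Mⱼ ∣ ≡ d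
    go i _ Mᵢ≢Mⱼ _ _ with <-cmp i j
    go i _ Mᵢ≢Mⱼ _ _ | tri≈ _ refl _ = contradiction refl Mᵢ≢Mⱼ
    go i _ _ σ⊆Mᵢ σ⊆Mⱼ | tri< i<j _ _ with shelling-step i<j σ⊆Mᵢ σ⊆Mⱼ
    ... | c , _ , σ⊆M_c , ∣M_c∩Mⱼ∣ =
      lookup M c , ∈-lookup (setoid _) M c , ≢Mⱼ ∣M_c∩Mⱼ∣ , σ⊆M_c , ∣M_c∩Mⱼ∣
    go i (acc earlier) Mᵢ≢Mⱼ σ⊆Mᵢ σ⊆Mⱼ | tri> _ _ j<i with shelling-step j<i σ⊆Mⱼ σ⊆Mᵢ
    ... | c , c<i , σ⊆M_c , ∣M_c∩Mᵢ∣ with lookup M c ≟ˢ Mⱼ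
    ...   | no M_c≢Mⱼ = go c (earlier c<i) M_c≢Mⱼ σ⊆M_c σ⊆Mⱼ
    ...   | yes M_c≡Mⱼ = lookup M i , ∈-lookup (setoid _) M i , Mᵢ≢Mⱼ , σ⊆Mᵢ , (begin
      ∣ lookup M i ∩ Mⱼ ∣        ≡⟨ cong ∣_∣ (∩-comm (lookup M i) Mⱼ) ⟩
      ∣ Mⱼ ∩ lookup M i ∣        ≡⟨ cong (λ X → ∣ X ∩ lookup M i ∣) (sym M_c≡Mⱼ) ⟩
      ∣ lookup M c ∩ lookup M i ∣ ≡⟨ ∣M_c∩Mᵢ∣ ⟩
      d                          ∎)

ShellingStep : ∀ {n} → ℕ → List (Subset n) → Subset n → Set
ShellingStep d earlier G = PureOfSize d (GeneratedL (map (_∩ G) earlier))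

adjoin : ∀ {n} → Family n → Subset n → Family n
adjoin Δ F = Generated (λ H → Δ H ⊎ H ≡ F)

module _ {n} {Δ : Family n} {F : Subset n} (F∉Δ : ¬ Δ F) where

  facet-adjoin-self : IsComplex Δ → Facet (adjoin Δ F) F
  facet-adjoin-self Δ-complex = (F , inj₂ refl , ⊆-refl) , maximal
    where
    maximal : ∀ H → adjoin Δ F H → F ⊆ H → H ≡ F
    maximal H (K , inj₁ K∈Δ , H⊆K) F⊆H = ⊥-elim (F∉Δ (Δ-complex K F (⊆-trans F⊆H H⊆K) K∈Δ))
    maximal H (K , inj₂ refl , H⊆K) F⊆H = ⊆-antisym H⊆K F⊆H

  facet-adjoin⁺ : ∀ {G} → Facet Δ G → ∣ F ∣ ≤ ∣ G ∣ → Facet (adjoin Δ F) G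
  facet-adjoin⁺ {G} (G∈Δ , G-maximal) ∣F∣≤∣G∣ = (G , inj₁ G∈Δ , ⊆-refl) , maximal
    where
    maximal : ∀ H → adjoin Δ F H → G ⊆ H → H ≡ G
    maximal H (K , inj₁ K∈Δ , H⊆K) G⊆H with G-maximal K K∈Δ (⊆-trans G⊆H H⊆K)
    ... | refl = ⊆-antisym H⊆K G⊆H
    maximal H (K , inj₂ refl , H⊆K) G⊆H =
      ⊥-elim (F∉Δ (subst Δ (p⊆q∧∣q∣≤∣p∣⇒p≡q (⊆-trans G⊆H H⊆K) ∣F∣≤∣G∣) G∈Δ))

  facet-adjoin⁻ : ∀ {G} → Facet (adjoin Δ F) G → G ≢ F → Facet Δ G
  facet-adjoin⁻ {G} ((K , K∈Δ⊎K≡F , G⊆K) , maximal) G≢F = G∈Δ K∈Δ⊎K≡F , G-maximal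
    where
    G∈Δ : Δ K ⊎ K ≡ F → Δ G
    G∈Δ (inj₁ K∈Δ) = subst Δ (maximal K (K , inj₁ K∈Δ , ⊆-refl) G⊆K) K∈Δ
    G∈Δ (inj₂ refl) = contradiction (sym (maximal K (K , inj₂ refl , ⊆-refl) G⊆K)) G≢F

    G-maximal : ∀ H → Δ H → G ⊆ H → H ≡ G
    G-maximal H H∈Δ = maximal H (H , inj₁ H∈Δ , ⊆-refl)

module Extension {n d} {Δ : Family n} {F : Subset n}
  (Δ-complex : IsComplex Δ) (Δ-pure : PureOfSize (suc d) Δ) (∣F∣ : ∣ F ∣ ≡ suc d) (F∉Δ : ¬ Δ F)
  {L : List (Subset n)} (L-shelling : IsShelling d Δ L) where

  private
    L-facets : ∀ {G} → G ∈ L → Facet Δ G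
    L-facets = proj₁ (proj₂ L-shelling) _

    facets-L : ∀ {G} → Facet Δ G → G ∈ L
    facets-L = proj₁ (proj₂ (proj₂ L-shelling)) _

    L-facets-adjoin : ∀ {G} → G ∈ L → Facet (adjoin Δ F) G
    L-facets-adjoin G∈L =
      facet-adjoin⁺ F∉Δ (L-facets G∈L) (≤-reflexive (trans ∣F∣ (sym (proj₂ Δ-pure _ (L-facets G∈L)))))

  F∉L : ¬ F ∈ L
  F∉L F∈L = F∉Δ (proj₁ (L-facets F∈L))

  private
    L-≢F : ∀ {G} → G ∈ L → G ≢ F
    L-≢F G∈L refl = F∉L G∈L

  facets-adjoin-∈ : ∀ {G} → Facet (adjoin Δ F) G → G ∈ L ++ [ F ]
  facets-adjoin-∈ {G} G-facet with G ≟ˢ F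
  ... | yes G≡F = ∈-++⁺ʳ L (here G≡F)
  ... | no G≢F = ∈-++⁺ˡ (facets-L (facet-adjoin⁻ F∉Δ G-facet G≢F))

  ∈-facets-adjoin : ∀ {G} → G ∈ L ++ [ F ] → Facet (adjoin Δ F) G
  ∈-facets-adjoin {G} G∈ =
    [ L-facets-adjoin , (λ { (here refl) → facet-adjoin-self F∉Δ Δ-complex }) ]′ (∈-++⁻ L G∈)

  last-shelling-step : ∀ {M} → IsShelling d (adjoin Δ F) M → ∀ {G₀} → G₀ ∈ L →
    ShellingStep d L F
  last-shelling-step {M} M-shelling G₀∈L = PureOfSize-GeneratedL (∈-map⁺ (_∩ F) G₀∈L) cover
    where
    facets-M : ∀ {G} → Facet (adjoin Δ F) G → G ∈ M
    facets-M = proj₁ (proj₂ (proj₂ M-shelling)) _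

    cover : ∀ {σ} → GeneratedL (map (_∩ F) L) σ → ∃ λ R → R ∈ map (_∩ F) L × σ ⊆ R × ∣ R ∣ ≡ d
    cover (H , H∈ , σ⊆H) with ∈-map⁻ (_∩ F) H∈
    ... | G , G∈L , refl
      with shelling-ridge M-shelling (facets-M (facet-adjoin-self F∉Δ Δ-complex)) ∣F∣
             (facets-M (L-facets-adjoin G∈L)) (L-≢F G∈L)
             (⊆-trans σ⊆H (p∩q⊆p _ _)) (⊆-trans σ⊆H (p∩q⊆q _ _))
    ... | C , C∈M , C≢F , σ⊆C , ∣C∩F∣ =
      C ∩ F , ∈-map⁺ (_∩ F) (facets-L (facet-adjoin⁻ F∉Δ (proj₁ (proj₂ M-shelling) C C∈M) C≢F)) ,
      ⊆-∩⁺ σ⊆C (⊆-trans σ⊆H (p∩q⊆q _ _)) , ∣C∩F∣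

lemma2p10 : (n d : ℕ) (Δ : Family n) → IsComplex Δ → Shellable d Δ →
    (F : Subset n) → ∣ F ∣ ≡ suc d → ¬ Δ F →
    Shellable d (Generated (λ H → Δ H ⊎ H ≡ F)) →
    (L : List (Subset n)) → IsShelling d Δ L →
    IsShelling d (Generated (λ H → Δ H ⊎ H ≡ F)) (L ++ [ F ])
lemma2p10 n d Δ Δ-complex (Δ-pure , _) F ∣F∣ F∉Δ (_ , M , M-shelling) L L-shelling =
  ++⁺ (proj₁ L-shelling) (All.[] ∷ []) (λ { (F∈L , here refl) → F∉L F∈L }) ,
  (λ _ → ∈-facets-adjoin) ,
  (λ _ → facets-adjoin-∈) ,
  Prefixwise-∷ʳ {Q = ShellingStep d} (proj₂ (proj₂ (proj₂ L-shelling))) (last-shelling-step M-shelling)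
  where open Extension Δ-complex Δ-pure ∣F∣ F∉Δ L-shelling
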